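{- There exist infinitely many integers $k$ such that $\Xi(k)=2k-2$.
   Context: All graphs are finite, simple and undirected. For a graph $G=(V,E)$ and $x\in V$, $N[x]=\{x\}\cup\{y: xy\in E\}$. A set $C\subseteq V$ is identifying if $N[x]\cap C\ne\emptyset$ for every $x\in V$ and $N[x]\cap C\neq N[y]\cap C$ for all distinct $x,y\in V$. For $n\ge k\ge1$, $\mathfrak{Gr}(n,k)$ is the set of graphs on $n$ vertices in which every $k$-element subset of vertices is identifying, and $\Xi(k)=\max\{n\ge k:\mathfrak{Gr}(n,k)\ne\emptyset\}$. -}

module Defs where

open import Data.Nat using (ℕ; _+_; _*_; _∸_; _≤_)
open import Data.Bool using (Bool; true; false; _∨_)
open import Data.Fin using (Fin; _≟_)
open import Data.Fin.Subset using (Subset; _∩_; ∣_∣; Nonempty)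
open import Data.Vec using (tabulate)
open import Data.Product using (Σ; _×_; ∃-syntax)
open import Relation.Nullary using (¬_; does)
open import Relation.Binary.PropositionalEquality using (_≡_; _≢_)

record Graph (n : ℕ) : Set where
  field
    adj     : Fin n → Fin n → Bool
    symm    : ∀ x y → adj x y ≡ adj y x
    irrefl  : ∀ x → adj x x ≡ false
open Graph public

closedNbhd : ∀ {n} (G : Graph n) → Fin n → Subset n
closedNbhd G x = tabulate λ y → does (x ≟ y) ∨ adj G x y

Identifying : ∀ {n} (G : Graph n) → Subset n → Set
Identifying {n} G C =
  (∀ x → Nonempty (closedNbhd G x ∩ C)) ×
  (∀ x y → x ≢ y → closedNbhd G x ∩ C ≢ closedNbhd G y ∩ C)

InGr : (n k : ℕ) → Graph n → Set
InGr n k G = ∀ (C : Subset n) → ∣ C ∣ ≡ k → Identifying G C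

GrNonempty : (n k : ℕ) → Set
GrNonempty n k = Σ (Graph n) (InGr n k)

XiEq : (k m : ℕ) → Set
XiEq k m = (k ≤ m) × GrNonempty m k × (∀ n → k ≤ n → GrNonempty n k → n ≤ m)

-- An n-set has a k-subset avoiding A iff |A| + k ≤ n. Hence G ∈ 𝔊𝔯(n,k) iff every closed
-- neighbourhood N[x] and every symmetric difference N[x] ⊕ N[y] (x ≠ y) has more than n − k elements.
--
-- Upper bound: the n closed neighbourhoods and the empty set are n + 1 binary words of length n
-- at pairwise Hamming distance at least e = n + 1 − k. Double counting the disagreements column
-- by column (Plotkin) gives 2e ≤ n + 1, and at equality all distances equal e; but the distances
-- of three words satisfy d(u,w) ≡ d(u,v) + d(v,w) (mod 2), so e is even. Hence Ξ(k) ≤ 2k − 2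
-- for odd k ≥ 3.
--
-- Lower bound: the ±1 Kronecker powers of the closed-neighbourhood matrix of the 4-cycle give a
-- graph on 4^(t+1) vertices in which every closed neighbourhood contains at least half of the
-- vertices and any two differ in at least half of them, i.e. a graph in 𝔊𝔯(2k − 2, k) for
-- k = 2·4^t + 1.

module Submission where

open import Defs
open import Data.Nat using (ℕ; _≤_; _*_; _∸_; suc)
open import Data.Product using (Σ; _×_)

open import Algebra.Bundles using (CommutativeRing)
open import Data.Bool using (Bool; true; false; not; _∧_; _∨_; _xor_)
open import Data.Bool.Properties using (xor-same; xor-comm; xor-assoc; xor-∧-commutativeRing)
import Data.Bool.Properties as Bool
open import Data.Fin using (Fin; zero; suc; _≟_; _↑ˡ_; _↑ʳ_; combine; remQuot; punchIn; punchOut)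
open import Data.Fin.Patterns using (0F; 1F; 2F; 3F)
open import Data.Fin.Properties
  using (all?; punchInᵢ≢i; punchIn-punchOut; remQuot-combine; combine-remQuot)
open import Data.Fin.Subset using (Subset; _∩_; ∁; _⊆_; ⊥; ∣_∣; Nonempty; Empty)
open import Data.Fin.Subset.Properties
  using (∣⊥∣≡0; ⊥⊆; s⊆s; p⊆q⇒∣p∣≤∣q∣; ∣p∣≤n; ∣∁p∣≡n∸∣p∣; p∩q⊆p; p∩q⊆q; x∈p∩q⁺; x∈∁p⇒x∉p; x∉p⇒x∈∁p;
         nonempty?; drop-∷-Empty)
open import Data.Nat using (zero; _+_; _^_; _<_; _<?_; _≤?_; z≤n; s≤s; >-nonZero)
open import Data.Nat.Divisibility using (_∣_; divides)
open import Data.Nat.Properties hiding (_≟_)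
import Data.Nat.Properties as ℕ
open import Data.Nat.Tactic.RingSolver using (solve-∀)
open import Data.Product using (_,_; proj₁; proj₂; ∃-syntax; uncurry)
open import Data.Sum using (inj₁; inj₂; [_,_]′)
open import Data.Vec using ([]; _∷_; here; there; lookup; tabulate; zipWith)
open import Data.Vec.Properties using (∷-injectiveʳ; lookup∘tabulate; lookup-zipWith)
open import Function using (_∘_; case_of_)
open import Function.Bundles using (_⇔_; mk⇔; Equivalence)
open import Relation.Binary.PropositionalEquality
  using (_≡_; _≢_; refl; sym; trans; cong; cong₂; subst; subst₂; module ≡-Reasoning)
open import Relation.Nullary using (¬_; contradiction; yes; no; does)
open import Relation.Nullary.Decidable using (dec-true; from-yes; ¬?; _×-dec_; _→-dec_)

open import Algebra.Properties.Semiring.Sum +-*-semiring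
  using (sum; sum-syntax; ∑-distrib-+; ∑-comm; sum-cong-≗; sum-remove; *-distribˡ-sum; *-distribʳ-sum)
open import Algebra.Properties.CommutativeSemigroup *-commutativeSemigroup
  using () renaming (x∙yz≈y∙xz to x*[y*z]≡y*[x*z])
open import Algebra.Properties.CommutativeSemigroup
  (CommutativeRing.+-commutativeSemigroup xor-∧-commutativeRing)
  using () renaming (interchange to xor-interchange)

∑-const : ∀ n c → ∑[ i < n ] c ≡ n * c
∑-const zero    c = refl
∑-const (suc n) c = cong (c +_) (∑-const n c)

∑-mono-≤ : ∀ {n} {f g : Fin n → ℕ} → (∀ i → f i ≤ g i) → sum f ≤ sum g
∑-mono-≤ {zero}  f≤g = z≤n
∑-mono-≤ {suc n} f≤g = +-mono-≤ (f≤g zero) (∑-mono-≤ (f≤g ∘ suc))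

∑-mono-< : ∀ {n} {f g : Fin n → ℕ} → (∀ i → f i ≤ g i) → ∀ i → f i < g i → sum f < sum g
∑-mono-< f≤g zero    f<g = +-mono-<-≤ f<g (∑-mono-≤ (f≤g ∘ suc))
∑-mono-< f≤g (suc i) f<g = +-mono-≤-< (f≤g zero) (∑-mono-< (f≤g ∘ suc) i f<g)

∑-++ : ∀ p q (f : Fin (p + q) → ℕ) → sum f ≡ ∑[ i < p ] f (i ↑ˡ q) + ∑[ j < q ] f (p ↑ʳ j)
∑-++ zero    q f = refl
∑-++ (suc p) q f = trans (cong (f zero +_) (∑-++ p q (f ∘ suc))) (sym (+-assoc (f zero) _ _))

∑-combine : ∀ p q (f : Fin (p * q) → ℕ) → sum f ≡ ∑[ i < p ] ∑[ j < q ] f (combine i j)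
∑-combine zero    q f = refl
∑-combine (suc p) q f =
  trans (∑-++ q (p * q) f) (cong (∑[ j < q ] f (j ↑ˡ (p * q)) +_) (∑-combine p q (f ∘ (q ↑ʳ_))))

bit : Bool → ℕ
bit false = 0
bit true  = 1

Word : ℕ → Set
Word n = Fin n → Bool

count : ∀ {n} → Word n → ℕ
count {n} u = ∑[ i < n ] bit (u i)

dist : ∀ {n} → Word n → Word n → ℕ
dist u v = count (λ i → u i xor v i)

count-cong : ∀ {n} {u v : Word n} → (∀ i → u i ≡ v i) → count u ≡ count v
count-cong u≗v = sum-cong-≗ (cong bit ∘ u≗v)

count-const-false : ∀ n → count {n} (λ _ → false) ≡ 0
count-const-false n = trans (∑-const n 0) (*-zeroʳ n)

count+count-not : ∀ {n} (u : Word n) → count u + count (not ∘ u) ≡ n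
count+count-not {n} u = begin
  count u + count (not ∘ u)         ≡⟨ ∑-distrib-+ (bit ∘ u) (bit ∘ not ∘ u) ⟨
  ∑[ i < n ] (bit (u i) + bit (not (u i))) ≡⟨ sum-cong-≗ (λ i → bit+bit-not (u i)) ⟩
  ∑[ i < n ] 1                       ≡⟨ trans (∑-const n 1) (*-identityʳ n) ⟩
  n                                  ∎
  where
  open ≡-Reasoning
  bit+bit-not : ∀ b → bit b + bit (not b) ≡ 1
  bit+bit-not false = refl
  bit+bit-not true  = refl

dist-self : ∀ {n} (u : Word n) → dist u u ≡ 0
dist-self {n} u = trans (count-cong (xor-same ∘ u)) (count-const-false n)

dist-comm : ∀ {n} (u v : Word n) → dist u v ≡ dist v u
dist-comm u v = count-cong (λ i → xor-comm (u i) (v i))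

agree : ∀ {n} → Word n → Word n → ℕ
agree u v = count (λ i → not (u i xor v i))

dist+agree : ∀ {n} (u v : Word n) → dist u v + agree u v ≡ n
dist+agree u v = count+count-not (λ i → u i xor v i)

agree-self : ∀ {n} (u : Word n) → agree u u ≡ n
agree-self u = trans (cong (_+ agree u u) (sym (dist-self u))) (dist+agree u u)

count-xorˡ : ∀ {n} b (v : Word n) → count (λ j → b xor v j) ≡ bit b * count (not ∘ v) + bit (not b) * count v
count-xorˡ false v = sym (+-identityʳ _)
count-xorˡ true  v = sym (trans (+-identityʳ _) (+-identityʳ _))

∑-count-xor : ∀ {m n} (u : Word m) (v : Word n) →
  ∑[ i < m ] count (λ j → u i xor v j) ≡ count u * count (not ∘ v) + count (not ∘ u) * count v
∑-count-xor {m} u v = begin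
  ∑[ i < m ] count (λ j → u i xor v j)                            ≡⟨ sum-cong-≗ (λ i → count-xorˡ (u i) v) ⟩
  ∑[ i < m ] (bit (u i) * count (not ∘ v) + bit (not (u i)) * count v)
    ≡⟨ ∑-distrib-+ (λ i → bit (u i) * count (not ∘ v)) (λ i → bit (not (u i)) * count v) ⟩
  ∑[ i < m ] (bit (u i) * count (not ∘ v)) + ∑[ i < m ] (bit (not (u i)) * count v)
    ≡⟨ cong₂ _+_ (*-distribʳ-sum _ (bit ∘ u)) (*-distribʳ-sum _ (bit ∘ not ∘ u)) ⟨
  count u * count (not ∘ v) + count (not ∘ u) * count v           ∎
  where open ≡-Reasoning

count-xor+count-∧ : ∀ {n} (u v : Word n) →
  count (λ i → u i xor v i) + 2 * count (λ i → u i ∧ v i) ≡ count u + count v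
count-xor+count-∧ {n} u v = begin
  dist u v + 2 * count (λ i → u i ∧ v i)
    ≡⟨ cong (dist u v +_) (*-distribˡ-sum 2 (λ i → bit (u i ∧ v i))) ⟩
  dist u v + ∑[ i < n ] (2 * bit (u i ∧ v i))
    ≡⟨ ∑-distrib-+ (λ i → bit (u i xor v i)) (λ i → 2 * bit (u i ∧ v i)) ⟨
  ∑[ i < n ] (bit (u i xor v i) + 2 * bit (u i ∧ v i))    ≡⟨ sum-cong-≗ (λ i → pointwise (u i) (v i)) ⟩
  ∑[ i < n ] (bit (u i) + bit (v i))                      ≡⟨ ∑-distrib-+ (bit ∘ u) (bit ∘ v) ⟩
  count u + count v                                       ∎
  where
  open ≡-Reasoning
  pointwise : ∀ a b → bit (a xor b) + 2 * bit (a ∧ b) ≡ bit a + bit b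
  pointwise false false = refl
  pointwise false true  = refl
  pointwise true  false = refl
  pointwise true  true  = refl

xor-telescope : ∀ a b c → (a xor b) xor (b xor c) ≡ a xor c
xor-telescope a b c = begin
  (a xor b) xor (b xor c) ≡⟨ xor-assoc a b (b xor c) ⟩
  a xor (b xor (b xor c)) ≡⟨ cong (a xor_) (xor-assoc b b c) ⟨
  a xor ((b xor b) xor c) ≡⟨ cong (λ x → a xor (x xor c)) (xor-same b) ⟩
  a xor c                 ∎
  where open ≡-Reasoning

-- A coordinate contributes 1 to dist u v + dist v w where u and w differ, and 0 or 2 elsewhere.
dist-parity : ∀ {n} (u v w : Word n) →
  dist u w + 2 * count (λ i → (u i xor v i) ∧ (v i xor w i)) ≡ dist u v + dist v w
dist-parity u v w = trans
  (cong (_+ 2 * count (λ i → (u i xor v i) ∧ (v i xor w i)))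
        (count-cong λ i → sym (xor-telescope (u i) (v i) (w i))))
  (count-xor+count-∧ (λ i → u i xor v i) (λ i → v i xor w i))

equilateral⇒even : ∀ {n e} (u v w : Word n) → dist u v ≡ e → dist v w ≡ e → dist u w ≡ e → 2 ∣ e
equilateral⇒even {e = e} u v w duv dvw duw =
  divides shared (trans (sym (+-cancelˡ-≡ e _ _ e+2s≡e+e)) (*-comm 2 shared))
  where
  shared : ℕ
  shared = count (λ i → (u i xor v i) ∧ (v i xor w i))
  e+2s≡e+e : e + 2 * shared ≡ e + e
  e+2s≡e+e = begin
    e + 2 * shared        ≡⟨ cong (_+ 2 * shared) duw ⟨
    dist u w + 2 * shared ≡⟨ dist-parity u v w ⟩
    dist u v + dist v w    ≡⟨ cong₂ _+_ duv dvw ⟩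
    e + e                  ∎
    where open ≡-Reasoning

4xy≤[x+y]² : ∀ x y → 4 * (x * y) ≤ (x + y) * (x + y)
4xy≤[x+y]² x y = [ ordered , ordered-swapped ]′ (≤-total x y)
  where
  square-of-sum : ∀ a d → 4 * (a * (a + d)) + d * d ≡ (a + (a + d)) * (a + (a + d))
  square-of-sum = solve-∀
  ordered : ∀ {a b} → a ≤ b → 4 * (a * b) ≤ (a + b) * (a + b)
  ordered {a} a≤b with m≤n⇒∃[o]m+o≡n a≤b
  ... | d , refl = ≤-trans (m≤m+n _ (d * d)) (≤-reflexive (square-of-sum a d))
  ordered-swapped : y ≤ x → 4 * (x * y) ≤ (x + y) * (x + y)
  ordered-swapped y≤x =
    subst₂ _≤_ (cong (4 *_) (*-comm y x)) (cong₂ _*_ (+-comm y x) (+-comm y x)) (ordered y≤x)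

-- The Plotkin bound

module Plotkin {m n} (c : Fin (suc m) → Word n) where

  distanceSum : ℕ
  distanceSum = ∑[ a < suc m ] ∑[ b < suc m ] dist (c a) (c b)

  distanceSum-upper : 2 * distanceSum ≤ n * (suc m * suc m)
  distanceSum-upper = begin
    2 * distanceSum                         ≡⟨ cong (2 *_) columnwise ⟩
    2 * ∑[ z < n ] disagreements z          ≡⟨ *-distribˡ-sum 2 disagreements ⟩
    ∑[ z < n ] (2 * disagreements z)        ≤⟨ ∑-mono-≤ column-bound ⟩
    ∑[ z < n ] (suc m * suc m)              ≡⟨ ∑-const n _ ⟩
    n * (suc m * suc m)                     ∎
    where
    open ≤-Reasoning
    column : Fin n → Word (suc m)
    column z a = c a z
    disagreements : Fin n → ℕ
    disagreements z = ∑[ a < suc m ] count (λ b → column z a xor column z b)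
    columnwise : distanceSum ≡ ∑[ z < n ] disagreements z
    columnwise = trans (sum-cong-≗ λ a → ∑-comm λ b z → bit (c a z xor c b z))
                       (∑-comm λ a z → ∑[ b < suc m ] bit (c a z xor c b z))
    column-bound : ∀ z → 2 * disagreements z ≤ suc m * suc m
    column-bound z = begin
      2 * disagreements z    ≡⟨ cong (2 *_) (∑-count-xor (column z) (column z)) ⟩
      2 * (w * w̄ + w̄ * w)    ≡⟨ 2[xy+yx]≡4xy w w̄ ⟩
      4 * (w * w̄)            ≤⟨ 4xy≤[x+y]² w w̄ ⟩
      (w + w̄) * (w + w̄)      ≡⟨ cong (λ M → M * M) (count+count-not (column z)) ⟩
      suc m * suc m          ∎
      where
      w w̄ : ℕ
      w = count (column z)
      w̄ = count (not ∘ column z)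
      2[xy+yx]≡4xy : ∀ x y → 2 * (x * y + y * x) ≡ 4 * (x * y)
      2[xy+yx]≡4xy = solve-∀

  module _ {e} (far : ∀ a b → a ≢ b → e ≤ dist (c a) (c b)) where

    rowSum : Fin (suc m) → ℕ
    rowSum a = ∑[ b < suc m ] dist (c a) (c b)

    rowSum-punchIn : ∀ a → rowSum a ≡ ∑[ j < m ] dist (c a) (c (punchIn a j))
    rowSum-punchIn a = trans (sum-remove {i = a} (dist (c a) ∘ c))
                             (cong (_+ ∑[ j < m ] dist (c a) (c (punchIn a j))) (dist-self (c a)))

    far-punchIn : ∀ a j → e ≤ dist (c a) (c (punchIn a j))
    far-punchIn a j = far a (punchIn a j) (punchInᵢ≢i a j ∘ sym)

    rowSum-lower : ∀ a → m * e ≤ rowSum a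
    rowSum-lower a = begin
      m * e                                   ≡⟨ ∑-const m e ⟨
      ∑[ j < m ] e                            ≤⟨ ∑-mono-≤ (far-punchIn a) ⟩
      ∑[ j < m ] dist (c a) (c (punchIn a j)) ≡⟨ rowSum-punchIn a ⟨
      rowSum a                                ∎
      where open ≤-Reasoning

    rowSum-lower-strict : ∀ {a b} → a ≢ b → e < dist (c a) (c b) → m * e < rowSum a
    rowSum-lower-strict {a} {b} a≢b e<d = begin-strict
      m * e                                   ≡⟨ ∑-const m e ⟨
      ∑[ j < m ] e                            <⟨ ∑-mono-< (far-punchIn a) (punchOut a≢b) e<d′ ⟩
      ∑[ j < m ] dist (c a) (c (punchIn a j)) ≡⟨ rowSum-punchIn a ⟨
      rowSum a                                ∎
      where
      open ≤-Reasoning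
      e<d′ : e < dist (c a) (c (punchIn a (punchOut a≢b)))
      e<d′ = subst (λ b′ → e < dist (c a) (c b′)) (sym (punchIn-punchOut a≢b)) e<d

    distanceSum-lower : suc m * (m * e) ≤ distanceSum
    distanceSum-lower = subst (_≤ distanceSum) (∑-const (suc m) (m * e)) (∑-mono-≤ rowSum-lower)

    distanceSum-lower-strict : ∀ {a b} → a ≢ b → e < dist (c a) (c b) → suc m * (m * e) < distanceSum
    distanceSum-lower-strict {a} a≢b e<d =
      subst (_< distanceSum) (∑-const (suc m) (m * e)) (∑-mono-< rowSum-lower a (rowSum-lower-strict a≢b e<d))

    plotkin : 2 * (m * e) ≤ n * suc m
    plotkin = *-cancelˡ-≤ (suc m) (begin
      suc m * (2 * (m * e)) ≡⟨ x*[y*z]≡y*[x*z] (suc m) 2 (m * e) ⟩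
      2 * (suc m * (m * e)) ≤⟨ *-monoʳ-≤ 2 distanceSum-lower ⟩
      2 * distanceSum       ≤⟨ distanceSum-upper ⟩
      n * (suc m * suc m)   ≡⟨ x*[y*z]≡y*[x*z] n (suc m) (suc m) ⟩
      suc m * (n * suc m)   ∎)
      where open ≤-Reasoning

    plotkin-strict : ∀ {a b} → a ≢ b → e < dist (c a) (c b) → 2 * (m * e) < n * suc m
    plotkin-strict a≢b e<d = *-cancelˡ-< (suc m) _ _ (begin-strict
      suc m * (2 * (m * e)) ≡⟨ x*[y*z]≡y*[x*z] (suc m) 2 (m * e) ⟩
      2 * (suc m * (m * e)) <⟨ *-monoʳ-< 2 (distanceSum-lower-strict a≢b e<d) ⟩
      2 * distanceSum       ≤⟨ distanceSum-upper ⟩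
      n * (suc m * suc m)   ≡⟨ x*[y*z]≡y*[x*z] n (suc m) (suc m) ⟩
      suc m * (n * suc m)   ∎)
      where open ≤-Reasoning

    plotkin-tight⇒even : ∀ {a b d} → a ≢ b → b ≢ d → a ≢ d → 2 * (m * e) ≡ n * suc m → 2 ∣ e
    plotkin-tight⇒even {a} {b} {d} a≢b b≢d a≢d tight =
      equilateral⇒even (c a) (c b) (c d) (exact a≢b) (exact b≢d) (exact a≢d)
      where
      exact : ∀ {a b} → a ≢ b → dist (c a) (c b) ≡ e
      exact {a} {b} a≢b with m≤n⇒m<n∨m≡n (far a b a≢b)
      ... | inj₁ e<d = contradiction (plotkin-strict a≢b e<d) (<-irrefl tight)
      ... | inj₂ e≡d = sym e≡d

plotkin-n+1 : ∀ {n e} (c : Fin (suc n) → Word n) → (∀ a b → a ≢ b → e ≤ dist (c a) (c b)) →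
  1 ≤ n → 2 * e ≤ suc n
plotkin-n+1 {n} {e} c far 1≤n = *-cancelˡ-≤ n {{>-nonZero 1≤n}}
  (subst (_≤ n * suc n) (x*[y*z]≡y*[x*z] 2 n e) (Plotkin.plotkin c far))

plotkin-n+1-tight⇒even : ∀ {n e} (c : Fin (suc n) → Word n) → (∀ a b → a ≢ b → e ≤ dist (c a) (c b)) →
  2 ≤ n → 2 * e ≡ suc n → 2 ∣ e
plotkin-n+1-tight⇒even {suc zero}    c far (s≤s ())
plotkin-n+1-tight⇒even {suc (suc n)} {e} c far _ 2e≡n+1 =
  Plotkin.plotkin-tight⇒even c far {zero} {suc zero} {suc (suc zero)} (λ ()) (λ ()) (λ ())
    (trans (x*[y*z]≡y*[x*z] 2 (suc (suc n)) e) (cong (suc (suc n) *_) 2e≡n+1))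

_⊕_ : ∀ {n} → Subset n → Subset n → Subset n
_⊕_ = zipWith _xor_

∣p∣≡count[lookup] : ∀ {n} (p : Subset n) → ∣ p ∣ ≡ count (lookup p)
∣p∣≡count[lookup] []          = refl
∣p∣≡count[lookup] (false ∷ p) = ∣p∣≡count[lookup] p
∣p∣≡count[lookup] (true  ∷ p) = cong suc (∣p∣≡count[lookup] p)

∣tabulate∣ : ∀ {n} (u : Word n) → ∣ tabulate u ∣ ≡ count u
∣tabulate∣ u = trans (∣p∣≡count[lookup] (tabulate u)) (count-cong (lookup∘tabulate u))

∣tabulate⊕tabulate∣ : ∀ {n} (u v : Word n) → ∣ tabulate u ⊕ tabulate v ∣ ≡ dist u v
∣tabulate⊕tabulate∣ u v = trans (∣p∣≡count[lookup] (tabulate u ⊕ tabulate v)) (count-cong λ i →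
  trans (lookup-zipWith _xor_ i (tabulate u) (tabulate v))
        (cong₂ _xor_ (lookup∘tabulate u i) (lookup∘tabulate v i)))

⊆∁⇔disjoint : ∀ {n} {p q : Subset n} → q ⊆ ∁ p ⇔ Empty (p ∩ q)
⊆∁⇔disjoint {p = p} {q} = mk⇔
  (λ q⊆∁p (x , x∈p∩q) → x∈∁p⇒x∉p (q⊆∁p (p∩q⊆q p q x∈p∩q)) (p∩q⊆p p q x∈p∩q))
  (λ p∩q-empty {x} x∈q → x∉p⇒x∈∁p λ x∈p → p∩q-empty (x , x∈p∩q⁺ (x∈p , x∈q)))

⊆-of-size : ∀ {n k} (p : Subset n) → k ≤ ∣ p ∣ → ∃[ q ] q ⊆ p × ∣ q ∣ ≡ k
⊆-of-size {n} {zero} p            _         = ⊥ , ⊥⊆ , ∣⊥∣≡0 n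
⊆-of-size {k = suc k} (true  ∷ p) (s≤s k≤p) with ⊆-of-size p k≤p
... | q , q⊆p , ∣q∣≡k = true ∷ q , s⊆s q⊆p , cong suc ∣q∣≡k
⊆-of-size {k = suc k} (false ∷ p) k<p       with ⊆-of-size p k<p
... | q , q⊆p , ∣q∣≡k = false ∷ q , s⊆s q⊆p , ∣q∣≡k

meets-every⇔large : ∀ {n k} (A : Subset n) → (∀ C → ∣ C ∣ ≡ k → Nonempty (A ∩ C)) ⇔ n < ∣ A ∣ + k
meets-every⇔large {n} {k} A = mk⇔ to from
  where
  fits-in-∁ : ∀ {C} → C ⊆ ∁ A → ∣ A ∣ + ∣ C ∣ ≤ n
  fits-in-∁ {C} C⊆∁A = subst (_≤ n) (+-comm ∣ C ∣ ∣ A ∣)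
    (m≤o∸n⇒m+n≤o ∣ C ∣ (∣p∣≤n A) (subst (∣ C ∣ ≤_) (∣∁p∣≡n∸∣p∣ A) (p⊆q⇒∣p∣≤∣q∣ C⊆∁A)))
  room-in-∁ : ∣ A ∣ + k ≤ n → k ≤ ∣ ∁ A ∣
  room-in-∁ A+k≤n =
    subst (k ≤_) (sym (∣∁p∣≡n∸∣p∣ A)) (m+n≤o⇒m≤o∸n k (subst (_≤ n) (+-comm ∣ A ∣ k) A+k≤n))
  to : (∀ C → ∣ C ∣ ≡ k → Nonempty (A ∩ C)) → n < ∣ A ∣ + k
  to meets with n <? ∣ A ∣ + k
  ... | yes n<A+k = n<A+k
  ... | no  n≮A+k with ⊆-of-size (∁ A) (room-in-∁ (≮⇒≥ n≮A+k))
  ...   | C , C⊆∁A , ∣C∣≡k = contradiction (meets C ∣C∣≡k) (Equivalence.to ⊆∁⇔disjoint C⊆∁A)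
  from : n < ∣ A ∣ + k → ∀ C → ∣ C ∣ ≡ k → Nonempty (A ∩ C)
  from n<A+k C ∣C∣≡k with nonempty? (A ∩ C)
  ... | yes A∩C≠∅ = A∩C≠∅
  ... | no  A∩C=∅ = contradiction
    (subst (λ c → ∣ A ∣ + c ≤ n) ∣C∣≡k (fits-in-∁ (Equivalence.from ⊆∁⇔disjoint A∩C=∅))) (<⇒≱ n<A+k)

⊕∩-empty⇒∩≡ : ∀ {n} (p q r : Subset n) → Empty ((p ⊕ q) ∩ r) → p ∩ r ≡ q ∩ r
⊕∩-empty⇒∩≡ []          []          []          _ = refl
⊕∩-empty⇒∩≡ (true  ∷ p) (false ∷ q) (true  ∷ r) e = contradiction (zero , here) e
⊕∩-empty⇒∩≡ (false ∷ p) (true  ∷ q) (true  ∷ r) e = contradiction (zero , here) e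
⊕∩-empty⇒∩≡ (true  ∷ p) (true  ∷ q) (s     ∷ r) e = cong (s ∷_) (⊕∩-empty⇒∩≡ p q r (drop-∷-Empty e))
⊕∩-empty⇒∩≡ (false ∷ p) (false ∷ q) (s     ∷ r) e = cong (false ∷_) (⊕∩-empty⇒∩≡ p q r (drop-∷-Empty e))
⊕∩-empty⇒∩≡ (true  ∷ p) (false ∷ q) (false ∷ r) e = cong (false ∷_) (⊕∩-empty⇒∩≡ p q r (drop-∷-Empty e))
⊕∩-empty⇒∩≡ (false ∷ p) (true  ∷ q) (false ∷ r) e = cong (false ∷_) (⊕∩-empty⇒∩≡ p q r (drop-∷-Empty e))

⊕∩-nonempty⇒∩≢ : ∀ {n} (p q r : Subset n) → Nonempty ((p ⊕ q) ∩ r) → p ∩ r ≢ q ∩ r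
⊕∩-nonempty⇒∩≢ (true  ∷ p) (false ∷ q) (true ∷ r) (zero , here) ()
⊕∩-nonempty⇒∩≢ (false ∷ p) (true  ∷ q) (true ∷ r) (zero , here) ()
⊕∩-nonempty⇒∩≢ (_ ∷ p) (_ ∷ q) (_ ∷ r) (suc x , there x∈) eq = ⊕∩-nonempty⇒∩≢ p q r (x , x∈) (∷-injectiveʳ eq)

⊕∩-nonempty⇔∩≢ : ∀ {n} (p q r : Subset n) → Nonempty ((p ⊕ q) ∩ r) ⇔ p ∩ r ≢ q ∩ r
⊕∩-nonempty⇔∩≢ p q r = mk⇔ (⊕∩-nonempty⇒∩≢ p q r) λ p∩r≢q∩r → case nonempty? ((p ⊕ q) ∩ r) of λ where
  (yes ne) → ne
  (no  e)  → contradiction (⊕∩-empty⇒∩≡ p q r e) p∩r≢q∩r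

nbhd : ∀ {n} → Graph n → Fin n → Word n
nbhd G x y = does (x ≟ y) ∨ adj G x y

NbhdBounds : (n k : ℕ) → Graph n → Set
NbhdBounds n k G =
  (∀ x → n < count (nbhd G x) + k) × (∀ x y → x ≢ y → n < dist (nbhd G x) (nbhd G y) + k)

InGr⇔NbhdBounds : ∀ {n k} (G : Graph n) → InGr n k G ⇔ NbhdBounds n k G
InGr⇔NbhdBounds {n} {k} G = mk⇔
  (λ inGr → (λ x → large (N x) (∣tabulate∣ (nbhd G x)) λ C ∣C∣≡k → proj₁ (inGr C ∣C∣≡k) x)
          , (λ x y x≢y → large (N x ⊕ N y) (∣tabulate⊕tabulate∣ (nbhd G x) (nbhd G y)) λ C ∣C∣≡k →
               Equivalence.from (⊕∩-nonempty⇔∩≢ (N x) (N y) C) (proj₂ (inGr C ∣C∣≡k) x y x≢y)))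
  (λ (bound , separated) C ∣C∣≡k →
      (λ x → meets (N x) (∣tabulate∣ (nbhd G x)) (bound x) C ∣C∣≡k)
    , (λ x y x≢y → Equivalence.to (⊕∩-nonempty⇔∩≢ (N x) (N y) C)
         (meets (N x ⊕ N y) (∣tabulate⊕tabulate∣ (nbhd G x) (nbhd G y)) (separated x y x≢y) C ∣C∣≡k)))
  where
  N : Fin n → Subset n
  N = closedNbhd G
  large : ∀ A {c} → ∣ A ∣ ≡ c → (∀ C → ∣ C ∣ ≡ k → Nonempty (A ∩ C)) → n < c + k
  large A refl = Equivalence.to (meets-every⇔large A)
  meets : ∀ A {c} → ∣ A ∣ ≡ c → n < c + k → ∀ C → ∣ C ∣ ≡ k → Nonempty (A ∩ C)
  meets A refl = Equivalence.from (meets-every⇔large A)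

-- The upper bound

-- The n closed neighbourhoods together with the empty set, whose distance to N[x] is ∣N[x]∣.
nbhdCode : ∀ {n} → Graph n → Fin (suc n) → Word n
nbhdCode G zero    = λ _ → false
nbhdCode G (suc x) = nbhd G x

nbhdCode-far : ∀ {n k e} (G : Graph n) → NbhdBounds n k G → suc n ≡ k + e →
  ∀ a b → a ≢ b → e ≤ dist (nbhdCode G a) (nbhdCode G b)
nbhdCode-far {k = k} {e} G (large , separated) n+1≡k+e = far
  where
  shift : ∀ {d} → _ < d + k → e ≤ d
  shift {d} n<d+k = +-cancelʳ-≤ k e d (subst (_≤ d + k) (trans n+1≡k+e (+-comm k e)) n<d+k)
  far : ∀ a b → a ≢ b → e ≤ dist (nbhdCode G a) (nbhdCode G b)
  far zero    zero    0≢0   = contradiction refl 0≢0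
  far zero    (suc y) _     = shift (large y)
  far (suc x) zero    _     = subst (e ≤_) (dist-comm (λ _ → false) (nbhd G x)) (shift (large x))
  far (suc x) (suc y) sx≢sy = shift (separated x y (sx≢sy ∘ cong suc))

-- If n ≥ 2k − 1 then the Plotkin bound forces n = 2k − 1, and its equality case makes k even.
GrNonempty⇒≤2k∸2 : ∀ {n k} → 2 ≤ k → ¬ 2 ∣ k → GrNonempty n k → n ≤ 2 * k ∸ 2
GrNonempty⇒≤2k∸2 {n} {k} 2≤k k-odd (G , inGr) with 2 * k ≤? suc n
... | no  2k≰n+1 = m+n≤o⇒m≤o∸n n (subst (_≤ 2 * k) (+-comm 2 n) (≰⇒> 2k≰n+1))
... | yes 2k≤n+1 with m≤n⇒∃[o]m+o≡n (≤-trans (m≤m+n k (k + 0)) 2k≤n+1)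
...   | e , k+e≡n+1 = contradiction (subst (2 ∣_) e≡k (plotkin-n+1-tight⇒even (nbhdCode G) far 2≤n 2e≡n+1)) k-odd
  where
  far : ∀ a b → a ≢ b → e ≤ dist (nbhdCode G a) (nbhdCode G b)
  far = nbhdCode-far G (Equivalence.to (InGr⇔NbhdBounds G) inGr) (sym k+e≡n+1)
  double : ∀ x → 2 * x ≡ x + x
  double x = cong (x +_) (+-identityʳ x)
  2≤n : 2 ≤ n
  2≤n = ≤-pred (≤-trans (s≤s (s≤s (s≤s z≤n))) (≤-trans (*-monoʳ-≤ 2 2≤k) 2k≤n+1))
  k≤e : k ≤ e
  k≤e = +-cancelˡ-≤ k k e (subst₂ _≤_ (double k) (sym k+e≡n+1) 2k≤n+1)
  e≤k : e ≤ k
  e≤k = +-cancelʳ-≤ e e k (subst₂ _≤_ (double e) (sym k+e≡n+1)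
          (plotkin-n+1 (nbhdCode G) far (≤-trans (s≤s z≤n) 2≤n)))
  e≡k : e ≡ k
  e≡k = ≤-antisym e≤k k≤e
  2e≡n+1 : 2 * e ≡ suc n
  2e≡n+1 = trans (double e) (trans (cong (_+ e) e≡k) k+e≡n+1)

-- The construction

-- With false, true read as +1, −1, this is the Kronecker product of ±1 vectors.
_⊗_ : ∀ {p q} → Word p → Word q → Word (p * q)
_⊗_ {p} {q} u v z = u (proj₁ (remQuot {p} q z)) xor v (proj₂ (remQuot {p} q z))

⊗-combine : ∀ {p q} (u : Word p) (v : Word q) i j → (u ⊗ v) (combine i j) ≡ u i xor v j
⊗-combine {p} {q} u v i j = cong (λ (i′ , j′) → u i′ xor v j′) (remQuot-combine {p} {q} i j)

count-⊗ : ∀ {p q} (u : Word p) (v : Word q) →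
  count (u ⊗ v) ≡ count u * count (not ∘ v) + count (not ∘ u) * count v
count-⊗ {p} {q} u v = begin
  count (u ⊗ v)                                   ≡⟨ ∑-combine p q (bit ∘ (u ⊗ v)) ⟩
  ∑[ i < p ] ∑[ j < q ] bit ((u ⊗ v) (combine i j)) ≡⟨ sum-cong-≗ (λ i → count-cong (⊗-combine u v i)) ⟩
  ∑[ i < p ] count (λ j → u i xor v j)            ≡⟨ ∑-count-xor u v ⟩
  count u * count (not ∘ v) + count (not ∘ u) * count v ∎
  where open ≡-Reasoning

dist-⊗ : ∀ {p q} (u u′ : Word p) (v v′ : Word q) →
  dist (u ⊗ v) (u′ ⊗ v′) ≡ dist u u′ * agree v v′ + agree u u′ * dist v v′
dist-⊗ {p} {q} u u′ v v′ = trans (count-cong λ z → xor-interchange (u (i z)) (v (j z)) (u′ (i z)) (v′ (j z)))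
                                 (count-⊗ (λ l → u l xor u′ l) (λ l → v l xor v′ l))
  where
  i = λ z → proj₁ (remQuot {p} q z)
  j = λ z → proj₂ (remQuot {p} q z)

-- The complement of the closed-neighbourhood relation of the 4-cycle 0 − 1 − 2 − 3 − 0.
antipodal : Fin 4 → Word 4
antipodal 0F 2F = true
antipodal 1F 3F = true
antipodal 2F 0F = true
antipodal 3F 1F = true
antipodal _  _  = false

antipodal-irrefl : ∀ i → antipodal i i ≡ false
antipodal-irrefl = from-yes (all? λ i → antipodal i i Bool.≟ false)

antipodal-sym : ∀ i j → antipodal i j ≡ antipodal j i
antipodal-sym = from-yes (all? λ i → all? λ j → antipodal i j Bool.≟ antipodal j i)

antipodal-counts : ∀ i → count (antipodal i) ≡ 1 × count (not ∘ antipodal i) ≡ 3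
antipodal-counts = from-yes (all? λ i → (count (antipodal i) ℕ.≟ 1) ×-dec (count (not ∘ antipodal i) ℕ.≟ 3))

antipodal-balanced : ∀ i j → i ≢ j → dist (antipodal i) (antipodal j) ≡ 2 × agree (antipodal i) (antipodal j) ≡ 2
antipodal-balanced = from-yes (all? λ i → all? λ j →
  ¬? (i ≟ j) →-dec ((dist (antipodal i) (antipodal j) ℕ.≟ 2) ×-dec (agree (antipodal i) (antipodal j) ℕ.≟ 2)))

-- Closed-neighbourhood matrix on Fin 4 × Fin (4 ^ t): (i , a) and (j , b) are adjacent iff
-- exactly one of "i, j antipodal" and "a, b adjacent" holds.
nbhdMatrix : ∀ t → Fin (4 ^ t) → Word (4 ^ t)
nbhdMatrix zero    _ _ = true
nbhdMatrix (suc t) x   = antipodal (proj₁ (remQuot {4} (4 ^ t) x)) ⊗ nbhdMatrix t (proj₂ (remQuot {4} (4 ^ t) x))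

nbhdMatrix-refl : ∀ t x → nbhdMatrix t x x ≡ true
nbhdMatrix-refl zero    x = refl
nbhdMatrix-refl (suc t) x = cong₂ _xor_ (antipodal-irrefl (proj₁ ix)) (nbhdMatrix-refl t (proj₂ ix))
  where ix = remQuot {4} (4 ^ t) x

nbhdMatrix-sym : ∀ t x y → nbhdMatrix t x y ≡ nbhdMatrix t y x
nbhdMatrix-sym zero    x y = refl
nbhdMatrix-sym (suc t) x y =
  cong₂ _xor_ (antipodal-sym (proj₁ ix) (proj₁ jy)) (nbhdMatrix-sym t (proj₂ ix) (proj₂ jy))
  where
  ix = remQuot {4} (4 ^ t) x
  jy = remQuot {4} (4 ^ t) y

nbhdMatrix-dense : ∀ t x → 4 ^ t ≤ 2 * count (nbhdMatrix t x)
nbhdMatrix-dense zero    x = s≤s z≤n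
nbhdMatrix-dense (suc t) x = begin
  4 * N                      ≡⟨ 4N≡2N+2N N ⟩
  2 * N + 2 * N              ≤⟨ +-monoʳ-≤ (2 * N) (*-monoʳ-≤ 2 (nbhdMatrix-dense t a)) ⟩
  2 * N + 2 * (2 * c)        ≡⟨ cong (λ n → 2 * n + 2 * (2 * c)) (count+count-not (nbhdMatrix t a)) ⟨
  2 * (c + c̄) + 2 * (2 * c)  ≡⟨ rearrange c c̄ ⟩
  2 * (1 * c̄ + 3 * c)
    ≡⟨ cong₂ (λ m m̄ → 2 * (m * c̄ + m̄ * c)) (proj₁ (antipodal-counts i)) (proj₂ (antipodal-counts i)) ⟨
  2 * (count (antipodal i) * c̄ + count (not ∘ antipodal i) * c)
    ≡⟨ cong (2 *_) (count-⊗ (antipodal i) (nbhdMatrix t a)) ⟨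
  2 * count (nbhdMatrix (suc t) x) ∎
  where
  open ≤-Reasoning
  N = 4 ^ t
  i = proj₁ (remQuot {4} N x)
  a = proj₂ (remQuot {4} N x)
  c = count (nbhdMatrix t a)
  c̄ = count (not ∘ nbhdMatrix t a)
  4N≡2N+2N : ∀ N → 4 * N ≡ 2 * N + 2 * N
  4N≡2N+2N = solve-∀
  rearrange : ∀ c c̄ → 2 * (c + c̄) + 2 * (2 * c) ≡ 2 * (1 * c̄ + 3 * c)
  rearrange = solve-∀

nbhdMatrix-separated : ∀ t {x y} → x ≢ y → 4 ^ t ≤ 2 * dist (nbhdMatrix t x) (nbhdMatrix t y)
nbhdMatrix-separated zero    {0F} {0F} 0≢0 = contradiction refl 0≢0
nbhdMatrix-separated (suc t) {x}  {y}  x≢y = step (remQuot N x) (remQuot N y) (x≢y ∘ remQuot-injective)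
  where
  N = 4 ^ t
  remQuot-injective : remQuot {4} N x ≡ remQuot N y → x ≡ y
  remQuot-injective eq =
    trans (sym (combine-remQuot {4} N x)) (trans (cong (uncurry combine) eq) (combine-remQuot N y))
  step : ∀ ((i , a) (j , b) : Fin 4 × Fin N) → (i , a) ≢ (j , b) →
         4 * N ≤ 2 * dist (antipodal i ⊗ nbhdMatrix t a) (antipodal j ⊗ nbhdMatrix t b)
  step (i , a) (j , b) ia≢jb with i ≟ j
  ... | yes refl = begin
    4 * N                 ≤⟨ *-monoʳ-≤ 4 (nbhdMatrix-separated t (ia≢jb ∘ cong (i ,_))) ⟩
    4 * (2 * d)           ≡⟨ x*[y*z]≡y*[x*z] 4 2 d ⟩
    2 * (4 * d)
      ≡⟨ cong₂ (λ δ α′ → 2 * (δ * α + α′ * d)) (dist-self (antipodal i)) (agree-self (antipodal i)) ⟨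
    2 * (dist (antipodal i) (antipodal i) * α + agree (antipodal i) (antipodal i) * d)
      ≡⟨ cong (2 *_) (dist-⊗ (antipodal i) (antipodal i) (nbhdMatrix t a) (nbhdMatrix t b)) ⟨
    2 * dist (antipodal i ⊗ nbhdMatrix t a) (antipodal i ⊗ nbhdMatrix t b) ∎
    where
    open ≤-Reasoning
    d = dist (nbhdMatrix t a) (nbhdMatrix t b)
    α = agree (nbhdMatrix t a) (nbhdMatrix t b)
  ... | no i≢j = ≤-reflexive (begin
    4 * N                 ≡⟨ *-assoc 2 2 N ⟩
    2 * (2 * N)           ≡⟨ cong (λ n → 2 * (2 * n)) (dist+agree (nbhdMatrix t a) (nbhdMatrix t b)) ⟨
    2 * (2 * (d′ + α))    ≡⟨ cong (2 *_) (rearrange d′ α) ⟩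
    2 * (2 * α + 2 * d′)  ≡⟨ cong (2 *_) (cong₂ (λ δ α′ → δ * α + α′ * d′) (proj₁ balanced) (proj₂ balanced)) ⟨
    2 * (dist (antipodal i) (antipodal j) * α + agree (antipodal i) (antipodal j) * d′)
      ≡⟨ cong (2 *_) (dist-⊗ (antipodal i) (antipodal j) (nbhdMatrix t a) (nbhdMatrix t b)) ⟨
    2 * dist (antipodal i ⊗ nbhdMatrix t a) (antipodal j ⊗ nbhdMatrix t b) ∎)
    where
    open ≡-Reasoning
    balanced = antipodal-balanced i j i≢j
    α = agree (nbhdMatrix t a) (nbhdMatrix t b)
    d′ = dist (nbhdMatrix t a) (nbhdMatrix t b)
    rearrange : ∀ d α → 2 * (d + α) ≡ 2 * α + 2 * d
    rearrange = solve-∀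

graphOf : ∀ {n} (R : Fin n → Word n) → (∀ x y → R x y ≡ R y x) → Graph n
graphOf R R-sym = record
  { adj    = λ x y → not (does (x ≟ y)) ∧ R x y
  ; symm   = λ x y → cong₂ (λ d r → not d ∧ r) (does-sym x y) (R-sym x y)
  ; irrefl = λ x → cong (λ d → not d ∧ R x x) (dec-true (x ≟ x) refl)
  }
  where
  does-sym : ∀ x y → does (x ≟ y) ≡ does (y ≟ x)
  does-sym x y with x ≟ y | y ≟ x
  ... | yes _   | yes _   = refl
  ... | no  _   | no  _   = refl
  ... | yes x≡y | no  y≢x = contradiction (sym x≡y) y≢x
  ... | no  x≢y | yes y≡x = contradiction (sym y≡x) x≢y

nbhd-graphOf : ∀ {n} (R : Fin n → Word n) (R-sym : ∀ x y → R x y ≡ R y x) → (∀ x → R x x ≡ true) →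
  ∀ x y → nbhd (graphOf R R-sym) x y ≡ R x y
nbhd-graphOf R R-sym R-refl x y with x ≟ y
... | yes refl = sym (R-refl x)
... | no  _    = refl

kroneckerGraph : ∀ t → Graph (4 ^ t)
kroneckerGraph t = graphOf (nbhdMatrix t) (nbhdMatrix-sym t)

kroneckerGraph-InGr : ∀ t → InGr (4 ^ suc t) (suc (2 * 4 ^ t)) (kroneckerGraph (suc t))
kroneckerGraph-InGr t = Equivalence.from (InGr⇔NbhdBounds G)
  ( (λ x → half (subst (λ c → 4 * N ≤ 2 * c) (sym (count-cong (nbhd-G x))) (nbhdMatrix-dense (suc t) x)))
  , (λ x y x≢y → half (subst (λ d → 4 * N ≤ 2 * d) (sym (count-cong λ z → cong₂ _xor_ (nbhd-G x z) (nbhd-G y z)))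
                                (nbhdMatrix-separated (suc t) x≢y))) )
  where
  N = 4 ^ t
  G = kroneckerGraph (suc t)
  nbhd-G : ∀ x y → nbhd G x y ≡ nbhdMatrix (suc t) x y
  nbhd-G = nbhd-graphOf (nbhdMatrix (suc t)) (nbhdMatrix-sym (suc t)) (nbhdMatrix-refl (suc t))
  half : ∀ {c} → 4 * N ≤ 2 * c → 4 * N < c + suc (2 * N)
  half {c} 4N≤2c = begin-strict
    4 * N           ≡⟨ *-assoc 2 2 N ⟩
    2 * (2 * N)     ≡⟨ cong (2 * N +_) (+-identityʳ (2 * N)) ⟩
    2 * N + 2 * N   ≤⟨ +-monoˡ-≤ (2 * N) (*-cancelˡ-≤ {2 * N} {c} 2 (subst (_≤ 2 * c) (*-assoc 2 2 N) 4N≤2c)) ⟩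
    c + 2 * N       <⟨ +-monoʳ-< c (n<1+n (2 * N)) ⟩
    c + suc (2 * N) ∎
    where open ≤-Reasoning

n<4^n : ∀ n → n < 4 ^ n
n<4^n zero    = s≤s z≤n
n<4^n (suc n) = ≤-<-trans (n<4^n n) (^-monoʳ-< 4 (s≤s (s≤s z≤n)) (n<1+n n))

corollary30 : ∀ (m : ℕ) → Σ ℕ λ k → (m ≤ k) × (1 ≤ k) × XiEq k (2 * k ∸ 2)
corollary30 m = k , m≤k , s≤s z≤n , k≤2k∸2 , lower , λ n _ → GrNonempty⇒≤2k∸2 (s≤s 1≤2N) k-odd
  where
  N = 4 ^ m
  k = suc (2 * N)
  1≤2N : 1 ≤ 2 * N
  1≤2N = ≤-trans (m^n>0 4 m) (m≤m+n N (N + 0))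
  m≤k : m ≤ k
  m≤k = ≤-trans (<⇒≤ (n<4^n m)) (≤-trans (m≤m+n N (N + 0)) (n≤1+n (2 * N)))
  2k∸2≡4N : 2 * k ∸ 2 ≡ 4 ^ suc m
  2k∸2≡4N = trans (cong (_∸ 2) (*-suc 2 (2 * N))) (trans (m+n∸m≡n 2 (2 * (2 * N))) (sym (*-assoc 2 2 N)))
  k≤2k∸2 : k ≤ 2 * k ∸ 2
  k≤2k∸2 = subst (k ≤_) (sym (trans 2k∸2≡4N (*-assoc 2 2 N)))
             (subst (k ≤_) (cong (2 * N +_) (sym (+-identityʳ (2 * N)))) (+-monoˡ-≤ (2 * N) 1≤2N))
  lower : GrNonempty (2 * k ∸ 2) k
  lower = subst (λ n → GrNonempty n k) (sym 2k∸2≡4N) (kroneckerGraph (suc m) , kroneckerGraph-InGr m)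
  k-odd : ¬ 2 ∣ k
  k-odd (divides q k≡2q) = even≢odd q N (trans (*-comm 2 q) (sym k≡2q))
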